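{- Fix an RSK growth diagram or a $d$-RSK growth diagram on a Young diagram $F$, and let $\alpha,\beta$ be partitions assigned to lattice points of $F$. Then: (i) if the lattice point of $\alpha$ lies weakly below and weakly to the left of that of $\beta$, then $\alpha_i\le\beta_i$ for all $i$; (ii) if the two lattice points are joined by a horizontal edge of $F$ with $\alpha$ to the left of $\beta$, then $|\beta|-|\alpha|$ equals the sum of the entries of the column of cells lying below that edge; if they are joined by a vertical edge with $\alpha$ below $\beta$, then $|\beta|-|\alpha|$ equals the sum of the entries of the row of cells lying to the left of that edge; (iii) reflecting all data of the growth diagram (the Young diagram, the filling, and the partitions) across the line $y=x$ yields a growth diagram of the same type (RSK, respectively $d$-RSK) on the reflected Young diagram.
   Context: Partitions: finite weakly decreasing sequences of positive integers $\lambda=(\lambda_1\ge\cdots\ge\lambda_m)$, with $\lambda_i=0$ for $i>m=\ell(\lambda)$ and $|\lambda|=\sum\lambda_i$; $\emptyset$ is the empty partition; a $d$-partition has $\ell(\lambda)\le d$. Write $\alpha\prec\beta$ (equivalently $\beta\succ\alpha$) if $\beta_1\ge\alpha_1\ge\beta_2\ge\alpha_2\ge\beta_3\ge\cdots$. The Young diagram of a partition lies in the first quadrant: row $i$ (counted from the bottom, the first row adjacent to the $x$-axis) consists of $\lambda_i$ left-justified unit cells with integer vertices; its lattice points are the vertices of its cells, its edges the sides of its cells. A filling assigns a nonnegative integer (entry) to each cell. A growth diagram on $F$ consists of a filling of $F$ and an assignment of a partition to each lattice point of $F$, with $\emptyset$ assigned to all lattice points on the coordinate axes, such that each cell satisfies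 a local rule. For a cell with entry $m$ and corner partitions $\kappa$ (bottom-left), $\mu$ (top-left), $\nu$ (bottom-right), $\rho$ (top-right): the RSK local rule requires $\mu\succ\kappa\prec\nu$, $\mu\prec\rho\succ\nu$, $\rho_1=m+\max(\mu_1,\nu_1)$ and $\rho_i+\kappa_{i-1}=\min(\mu_{i-1},\nu_{i-1})+\max(\mu_i,\nu_i)$ for all $i\ge2$. The $d$-RSK local rule requires all four partitions to be $d$-partitions, $\mu\succ\kappa\prec\nu$, $\mu\prec\rho\succ\nu$, that $m=0$ or $\kappa_d=0$, and $\rho_1+\kappa_d=m+\min(\mu_d,\nu_d)+\max(\mu_1,\nu_1)$ and $\rho_i+\kappa_{i-1}=\min(\mu_{i-1},\nu_{i-1})+\max(\mu_i,\nu_i)$ for $2\le i\le d$. An RSK (resp. $d$-RSK) growth diagram is one in which every cell satisfies the RSK (resp. $d$-RSK) local rule. -}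

module Defs where

open import Data.Nat using (ℕ; zero; suc; _+_; _≤_; _<_; _⊔_; _⊓_; _≤?_)
open import Data.List using (List; []; _∷_; length; applyUpTo; filter)
open import Data.Nat.ListAction using (sum)
open import Data.List.Relation.Unary.All using (All)
open import Data.List.Relation.Unary.Linked using (Linked)
open import Data.Product using (Σ; _×_)
open import Data.Sum using (_⊎_)
open import Data.Unit using (⊤)
open import Relation.Binary.PropositionalEquality using (_≡_)

IsPartition : List ℕ → Set
IsPartition l = Linked (λ a b → b ≤ a) l × All (λ a → 1 ≤ a) l

-- 1-based access: λ ⟨ i ⟩ = λᵢ for i ≥ 1, and λᵢ = 0 for i > ℓ(λ).
-- (Convention λ ⟨ 0 ⟩ = 0; index 0 is never used by the definitions.)
_⟨_⟩ : List ℕ → ℕ → ℕ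
l ⟨ zero ⟩ = 0
[] ⟨ suc i ⟩ = 0
(x ∷ l) ⟨ suc zero ⟩ = x
(x ∷ l) ⟨ suc (suc i) ⟩ = l ⟨ suc i ⟩

size : List ℕ → ℕ
size = sum

IsDPartition : ℕ → List ℕ → Set
IsDPartition d l = length l ≤ d

_≺_ : List ℕ → List ℕ → Set
α ≺ β = ∀ i → α ⟨ suc i ⟩ ≤ β ⟨ suc i ⟩ × β ⟨ suc (suc i) ⟩ ≤ α ⟨ suc i ⟩

-- Young diagram of a partition F (row i counted from the bottom).
-- The cell with bottom-left corner (x , y) belongs to F iff x < F_{y+1}.

InF : List ℕ → ℕ → ℕ → Set
InF F x y = x < F ⟨ suc y ⟩

LatticePt : List ℕ → ℕ → ℕ → Set
LatticePt F x y =
  Σ ℕ λ a → Σ ℕ λ b → InF F a b × (x ≡ a ⊎ x ≡ suc a) × (y ≡ b ⊎ y ≡ suc b)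

-- The horizontal segment from (x , y) to (x+1 , y) is an edge of F.
HEdge : List ℕ → ℕ → ℕ → Set
HEdge F x y = InF F x y ⊎ Σ ℕ λ b → y ≡ suc b × InF F x b

-- The vertical segment from (x , y) to (x , y+1) is an edge of F.
VEdge : List ℕ → ℕ → ℕ → Set
VEdge F x y = InF F x y ⊎ Σ ℕ λ a → x ≡ suc a × InF F a y

colSum : (ℕ → ℕ → ℕ) → ℕ → ℕ → ℕ
colSum f x y = sum (applyUpTo (λ j → f x j) y)

rowSum : (ℕ → ℕ → ℕ) → ℕ → ℕ → ℕ
rowSum f x y = sum (applyUpTo (λ i → f i y) x)

-- Conjugate partition: λ'_j = #{ i : λ_i ≥ j }, for 1 ≤ j ≤ λ₁.
-- Its Young diagram is the reflection of that of λ across y = x.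
conj : List ℕ → List ℕ
conj F = applyUpTo (λ j → length (filter (λ r → suc j ≤? r) F)) (F ⟨ 1 ⟩)

-- Local rules.  Cell with entry m, corners κ (bottom-left), μ (top-left),
-- ν (bottom-right), ρ (top-right).

RSKRule : ℕ → (κ μ ν ρ : List ℕ) → Set
RSKRule m κ μ ν ρ =
  (κ ≺ μ) × (κ ≺ ν) × (μ ≺ ρ) × (ν ≺ ρ) ×
  (ρ ⟨ 1 ⟩ ≡ m + (μ ⟨ 1 ⟩ ⊔ ν ⟨ 1 ⟩)) ×
  (∀ i → 2 ≤ i →
     ρ ⟨ i ⟩ + κ ⟨ i Data.Nat.∸ 1 ⟩
       ≡ (μ ⟨ i Data.Nat.∸ 1 ⟩ ⊓ ν ⟨ i Data.Nat.∸ 1 ⟩) + (μ ⟨ i ⟩ ⊔ ν ⟨ i ⟩))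

DRSKRule : ℕ → ℕ → (κ μ ν ρ : List ℕ) → Set
DRSKRule d m κ μ ν ρ =
  IsDPartition d κ × IsDPartition d μ × IsDPartition d ν × IsDPartition d ρ ×
  (κ ≺ μ) × (κ ≺ ν) × (μ ≺ ρ) × (ν ≺ ρ) ×
  (m ≡ 0 ⊎ κ ⟨ d ⟩ ≡ 0) ×
  (ρ ⟨ 1 ⟩ + κ ⟨ d ⟩ ≡ m + (μ ⟨ d ⟩ ⊓ ν ⟨ d ⟩) + (μ ⟨ 1 ⟩ ⊔ ν ⟨ 1 ⟩)) ×
  (∀ i → 2 ≤ i → i ≤ d →
     ρ ⟨ i ⟩ + κ ⟨ i Data.Nat.∸ 1 ⟩
       ≡ (μ ⟨ i Data.Nat.∸ 1 ⟩ ⊓ ν ⟨ i Data.Nat.∸ 1 ⟩) + (μ ⟨ i ⟩ ⊔ ν ⟨ i ⟩))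

data Kind : Set where
  rsk  : Kind
  drsk : ℕ → Kind

KindOK : Kind → Set
KindOK rsk      = ⊤
KindOK (drsk d) = 1 ≤ d

LocalRule : Kind → ℕ → (κ μ ν ρ : List ℕ) → Set
LocalRule rsk      = RSKRule
LocalRule (drsk d) = DRSKRule d

-- Growth diagram of kind k on the Young diagram of F, with filling f
-- (f x y = entry of cell with bottom-left corner (x , y)) and partition
-- assignment P (P x y = partition at lattice point (x , y)).
-- Values of f, P outside F are irrelevant.

record GrowthDiagram (k : Kind) (F : List ℕ) (f : ℕ → ℕ → ℕ)
                     (P : ℕ → ℕ → List ℕ) : Set where
  field
    shape  : IsPartition F
    parts  : ∀ x y → LatticePt F x y → IsPartition (P x y)
    axisX  : ∀ x → LatticePt F x 0 → P x 0 ≡ []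
    axisY  : ∀ y → LatticePt F 0 y → P 0 y ≡ []
    local  : ∀ x y → InF F x y →
               LocalRule k (f x y) (P x y) (P x (suc y)) (P (suc x) y) (P (suc x) (suc y))

module Submission where

-- Each cell's local rule makes its four corners interlace, so entries grow along every
-- up-and-right lattice path, giving (i). Summing the d-RSK equations of a cell over i
-- telescopes, and min + max = μᵢ + νᵢ yields |ρ| + |κ| = m + |μ| + |ν|; an RSK cell
-- satisfies the d-RSK equations for any d beyond all lengths. Adding this law up the
-- cells of a column (or along a row) gives (ii). The local rules are symmetric in μ and
-- ν, and the conjugate partition describes the reflected Young diagram, giving (iii).

open import Defs
open import Data.Nat using (ℕ; zero; suc; _+_; _≤_; _<_; _⊔_; _⊓_; _≤?_; _∸_; z≤n; s≤s; pred)
open import Data.Nat.Properties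
open import Algebra.Properties.CommutativeSemigroup +-commutativeSemigroup using (interchange)
open import Data.Nat.ListAction using (sum)
open import Data.Nat.ListAction.Properties using (sum-++)
open import Data.Nat.Solver using (module +-*-Solver)
open import Data.List using (List; []; _∷_; length; applyUpTo; filter)
open import Data.List.Properties using (applyUpTo-∷ʳ; filter-accept; filter-none)
open import Data.List.Relation.Unary.All as All using (All)
open import Data.List.Relation.Unary.All.Properties using (applyUpTo⁺₁)
open import Data.List.Relation.Unary.Linked as Linked using (Linked; [-]; _∷_)
open import Data.List.Relation.Unary.Linked.Properties using (Linked⇒All; applyUpTo⁺₂)
open import Data.List.Relation.Binary.Sublist.Propositional using (⊆-refl)
open import Data.List.Relation.Binary.Sublist.Propositional.Properties using (filter⁺)
open import Data.List.Relation.Binary.Sublist.Heterogeneous.Properties using (length-mono-≤)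
open import Data.Product using (_×_; _,_; proj₁)
open import Data.Sum using (_⊎_; inj₁; inj₂)
open import Function using (_∘_)
open import Relation.Nullary using (yes; no)
open import Relation.Binary.PropositionalEquality
open ≡-Reasoning
open +-*-Solver using (solve; _:=_; _:+_)

∑ : ℕ → (ℕ → ℕ) → ℕ
∑ n g = sum (applyUpTo g n)

∑-snoc : ∀ g n → ∑ (suc n) g ≡ ∑ n g + g n
∑-snoc g n = begin
  sum (applyUpTo g (suc n))            ≡⟨ cong sum (applyUpTo-∷ʳ g n) ⟨
  sum (applyUpTo g n Data.List.∷ʳ g n) ≡⟨ sum-++ (applyUpTo g n) _ ⟩
  ∑ n g + (g n + 0)                    ≡⟨ cong (∑ n g +_) (+-identityʳ (g n)) ⟩
  ∑ n g + g n                          ∎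

∑-cong : ∀ {g h} n → (∀ i → i < n → g i ≡ h i) → ∑ n g ≡ ∑ n h
∑-cong zero            _  = refl
∑-cong {g} {h} (suc n) eq =
  cong₂ _+_ (eq 0 (s≤s z≤n)) (∑-cong {g ∘ suc} {h ∘ suc} n (λ i i<n → eq (suc i) (s≤s i<n)))

∑-distrib-+ : ∀ g h n → ∑ n (λ i → g i + h i) ≡ ∑ n g + ∑ n h
∑-distrib-+ g h zero    = refl
∑-distrib-+ g h (suc n) =
  trans (cong (g 0 + h 0 +_) (∑-distrib-+ (g ∘ suc) (h ∘ suc) n)) (interchange (g 0) (h 0) _ _)

∑-zero : ∀ n → ∑ n (λ _ → 0) ≡ 0
∑-zero zero    = refl
∑-zero (suc n) = ∑-zero n

∑-cyclic-telescope : ∀ (R K G H : ℕ → ℕ) m n →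
  R 0 + K n ≡ m + G n + H 0 →
  (∀ i → i < n → R (suc i) + K i ≡ G i + H (suc i)) →
  ∑ (suc n) R + ∑ (suc n) K ≡ m + ∑ (suc n) G + ∑ (suc n) H
∑-cyclic-telescope R K G H m n first step = begin
  ∑ (suc n) R + ∑ (suc n) K
    ≡⟨ cong (∑ (suc n) R +_) (trans (∑-snoc K n) (+-comm (∑ n K) (K n))) ⟩
  (R 0 + ∑ n (R ∘ suc)) + (K n + ∑ n K)
    ≡⟨ interchange (R 0) _ (K n) _ ⟩
  (R 0 + K n) + (∑ n (R ∘ suc) + ∑ n K)
    ≡⟨ cong₂ _+_ first (sym (∑-distrib-+ (R ∘ suc) K n)) ⟩
  (m + G n + H 0) + ∑ n (λ i → R (suc i) + K i)
    ≡⟨ cong (m + G n + H 0 +_) (trans (∑-cong n step) (∑-distrib-+ G (H ∘ suc) n)) ⟩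
  (m + G n + H 0) + (∑ n G + ∑ n (H ∘ suc))
    ≡⟨ solve 5 (λ m g h s t → (m :+ g :+ h) :+ (s :+ t) := m :+ (s :+ g) :+ (h :+ t))
             refl m (G n) (H 0) (∑ n G) (∑ n (H ∘ suc)) ⟩
  m + (∑ n G + G n) + (H 0 + ∑ n (H ∘ suc))
    ≡⟨ cong (λ s → m + s + ∑ (suc n) H) (∑-snoc G n) ⟨
  m + ∑ (suc n) G + ∑ (suc n) H
    ∎

∑-along-strip : ∀ (a b m : ℕ → ℕ) n → a 0 ≡ b 0 →
  (∀ j → j < n → b (suc j) + a j ≡ m j + a (suc j) + b j) →
  a n + ∑ n m ≡ b n
∑-along-strip a b m zero    base _    = trans (+-identityʳ (a 0)) base
∑-along-strip a b m (suc n) base step = +-cancelʳ-≡ (a n) _ _ (begin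
  a (suc n) + ∑ (suc n) m + a n     ≡⟨ cong (λ s → a (suc n) + s + a n) (∑-snoc m n) ⟩
  a (suc n) + (∑ n m + m n) + a n
    ≡⟨ solve 4 (λ x s y z → x :+ (s :+ y) :+ z := y :+ x :+ (z :+ s)) refl (a (suc n)) (∑ n m) (m n) (a n) ⟩
  m n + a (suc n) + (a n + ∑ n m)   ≡⟨ cong (m n + a (suc n) +_) (∑-along-strip a b m n base (λ j j<n → step j (m<n⇒m<1+n j<n))) ⟩
  m n + a (suc n) + b n             ≡⟨ step n ≤-refl ⟨
  b (suc n) + a n                   ∎)

≤-chain : ∀ (g : ℕ → ℕ) {m n} → (∀ j → j < n → g j ≤ g (suc j)) → m ≤ n → g m ≤ g n
≤-chain g {n = zero}  _    z≤n = ≤-refl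
≤-chain g {n = suc n} step m≤1+n with m≤n⇒m<n∨m≡n m≤1+n
... | inj₂ refl        = ≤-refl
... | inj₁ (s≤s m≤n) = ≤-trans (≤-chain g (λ j j<n → step j (m<n⇒m<1+n j<n)) m≤n) (step n ≤-refl)

m⊓n+m⊔n≡m+n : ∀ m n → (m ⊓ n) + (m ⊔ n) ≡ m + n
m⊓n+m⊔n≡m+n m n with ≤-total m n
... | inj₁ m≤n rewrite m≤n⇒m⊓n≡m m≤n | m≤n⇒m⊔n≡n m≤n = refl
... | inj₂ n≤m rewrite m≥n⇒m⊓n≡n n≤m | m≥n⇒m⊔n≡m n≤m = +-comm n m

entry-beyond-length : ∀ l n → length l ≤ n → l ⟨ suc n ⟩ ≡ 0
entry-beyond-length []          n       _         = refl
entry-beyond-length (x ∷ [])    (suc n) _         = refl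
entry-beyond-length (x ∷ y ∷ l) (suc n) (s≤s len) = entry-beyond-length (y ∷ l) n len

size≡∑-entries : ∀ l n → length l ≤ n → size l ≡ ∑ n (λ i → l ⟨ suc i ⟩)
size≡∑-entries []      n       _         = sym (∑-zero n)
size≡∑-entries (x ∷ l) (suc n) (s≤s len) = cong (x +_) (size≡∑-entries l n len)

CellSizeLaw : ℕ → (κ μ ν ρ : List ℕ) → Set
CellSizeLaw m κ μ ν ρ = size ρ + size κ ≡ m + size μ + size ν

DRSKEquations : ℕ → ℕ → (κ μ ν ρ : List ℕ) → Set
DRSKEquations d m κ μ ν ρ =
  (ρ ⟨ 1 ⟩ + κ ⟨ d ⟩ ≡ m + (μ ⟨ d ⟩ ⊓ ν ⟨ d ⟩) + (μ ⟨ 1 ⟩ ⊔ ν ⟨ 1 ⟩)) ×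
  (∀ i → 2 ≤ i → i ≤ d →
     ρ ⟨ i ⟩ + κ ⟨ i ∸ 1 ⟩
       ≡ (μ ⟨ i ∸ 1 ⟩ ⊓ ν ⟨ i ∸ 1 ⟩) + (μ ⟨ i ⟩ ⊔ ν ⟨ i ⟩))

-- Read cyclically, κ_d pairs with ρ₁ just as κ_{i-1} pairs with ρ_i, so the equations telescope.
drskEquations⇒sizeLaw : ∀ n m κ μ ν ρ →
  IsDPartition (suc n) κ → IsDPartition (suc n) μ → IsDPartition (suc n) ν → IsDPartition (suc n) ρ →
  DRSKEquations (suc n) m κ μ ν ρ → CellSizeLaw m κ μ ν ρ
drskEquations⇒sizeLaw n m κ μ ν ρ lκ lμ lν lρ (first , rest) = begin
  size ρ + size κ          ≡⟨ cong₂ _+_ (size≡∑-entries ρ d lρ) (size≡∑-entries κ d lκ) ⟩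
  ∑ d R + ∑ d K            ≡⟨ ∑-cyclic-telescope R K G H m n first
                                (λ i i<n → rest (suc (suc i)) (s≤s (s≤s z≤n)) (s≤s i<n)) ⟩
  m + ∑ d G + ∑ d H        ≡⟨ +-assoc m _ _ ⟩
  m + (∑ d G + ∑ d H)      ≡⟨ cong (m +_) (sym (∑-distrib-+ G H d)) ⟩
  m + ∑ d (λ i → G i + H i) ≡⟨ cong (m +_) (∑-cong d (λ i _ → m⊓n+m⊔n≡m+n (M i) (N i))) ⟩
  m + ∑ d (λ i → M i + N i) ≡⟨ cong (m +_) (∑-distrib-+ M N d) ⟩
  m + (∑ d M + ∑ d N)      ≡⟨ +-assoc m _ _ ⟨
  m + ∑ d M + ∑ d N        ≡⟨ cong₂ (λ s t → m + s + t) (size≡∑-entries μ d lμ) (size≡∑-entries ν d lν) ⟨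
  m + size μ + size ν      ∎
  where
  d : ℕ
  d = suc n
  R K M N G H : ℕ → ℕ
  R i = ρ ⟨ suc i ⟩
  K i = κ ⟨ suc i ⟩
  M i = μ ⟨ suc i ⟩
  N i = ν ⟨ suc i ⟩
  G i = M i ⊓ N i
  H i = M i ⊔ N i

rsk⇒drskEquations : ∀ n m κ μ ν ρ → length κ ≤ n → length μ ≤ n →
  RSKRule m κ μ ν ρ → DRSKEquations (suc n) m κ μ ν ρ
rsk⇒drskEquations n m κ μ ν ρ lκ lμ (_ , _ , _ , _ , first , rest) =
  first′ , λ i 2≤i _ → rest i 2≤i
  where
  first′ : ρ ⟨ 1 ⟩ + κ ⟨ suc n ⟩ ≡ m + (μ ⟨ suc n ⟩ ⊓ ν ⟨ suc n ⟩) + (μ ⟨ 1 ⟩ ⊔ ν ⟨ 1 ⟩)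
  first′ rewrite entry-beyond-length κ n lκ | entry-beyond-length μ n lμ
    = trans (+-identityʳ _) (trans first (cong (_+ (μ ⟨ 1 ⟩ ⊔ ν ⟨ 1 ⟩)) (sym (+-identityʳ m))))

localRule⇒sizeLaw : ∀ k → KindOK k → ∀ {m κ μ ν ρ} → LocalRule k m κ μ ν ρ → CellSizeLaw m κ μ ν ρ
localRule⇒sizeLaw rsk _ {m} {κ} {μ} {ν} {ρ} rule =
  drskEquations⇒sizeLaw n m κ μ ν ρ (m≤n⇒m≤1+n lκ) (m≤n⇒m≤1+n lμ) (m≤n⇒m≤1+n lν) (m≤n⇒m≤1+n lρ)
    (rsk⇒drskEquations n m κ μ ν ρ lκ lμ rule)
  where
  n : ℕ
  n = (length κ ⊔ length μ) ⊔ (length ν ⊔ length ρ)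
  lκ : length κ ≤ n
  lμ : length μ ≤ n
  lν : length ν ≤ n
  lρ : length ρ ≤ n
  lκ = ≤-trans (m≤m⊔n (length κ) (length μ)) (m≤m⊔n _ (length ν ⊔ length ρ))
  lμ = ≤-trans (m≤n⊔m (length κ) (length μ)) (m≤m⊔n _ (length ν ⊔ length ρ))
  lν = ≤-trans (m≤m⊔n (length ν) (length ρ)) (m≤n⊔m (length κ ⊔ length μ) _)
  lρ = ≤-trans (m≤n⊔m (length ν) (length ρ)) (m≤n⊔m (length κ ⊔ length μ) _)
localRule⇒sizeLaw (drsk (suc n)) _ (lκ , lμ , lν , lρ , _ , _ , _ , _ , _ , equations) =
  drskEquations⇒sizeLaw n _ _ _ _ _ lκ lμ lν lρ equations

Descending : List ℕ → Set
Descending = Linked (λ a b → b ≤ a)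

tail⟨1⟩≤head : ∀ {x F} → Descending (x ∷ F) → F ⟨ 1 ⟩ ≤ x
tail⟨1⟩≤head [-]       = z≤n
tail⟨1⟩≤head (x≥y ∷ _) = x≥y

⟨⟩-descending : ∀ {F} → Descending F → ∀ {j b} → j ≤ b → F ⟨ suc b ⟩ ≤ F ⟨ suc j ⟩
⟨⟩-descending {[]}    _ _ = z≤n
⟨⟩-descending {x ∷ F} D {zero}  {zero}  _         = ≤-refl
⟨⟩-descending {x ∷ F} D {zero}  {suc b} _         = ≤-trans (⟨⟩-descending (Linked.tail D) z≤n) (tail⟨1⟩≤head D)
⟨⟩-descending {x ∷ F} D {suc j} {suc b} (s≤s j≤b) = ⟨⟩-descending (Linked.tail D) j≤b

≡⊎≡suc⇒≤suc : ∀ {x a} → x ≡ a ⊎ x ≡ suc a → x ≤ suc a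
≡⊎≡suc⇒≤suc (inj₁ refl) = n≤1+n _
≡⊎≡suc⇒≤suc (inj₂ refl) = ≤-refl

latticePt-leftward : ∀ {F x x′ y} → LatticePt F x′ y → x ≤ x′ → LatticePt F x y
latticePt-leftward {x = x} (a , b , cell , x′-corner , y-corner) x≤x′
  with m≤n⇒m<n∨m≡n (≤-trans x≤x′ (≡⊎≡suc⇒≤suc x′-corner))
... | inj₁ (s≤s x≤a) = x , b , ≤-<-trans x≤a cell , inj₁ refl , y-corner
... | inj₂ refl       = a , b , cell , inj₂ refl , y-corner

<corner⇒≤ : ∀ {i x a} → i < x → x ≡ a ⊎ x ≡ suc a → i ≤ a
<corner⇒≤ i<x corner = ≤-pred (≤-trans i<x (≡⊎≡suc⇒≤suc corner))

latticePt⇒hEdge : ∀ {F x y i} → LatticePt F x y → i < x → HEdge F i y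
latticePt⇒hEdge (a , b , cell , x-corner , inj₁ refl) i<x =
  inj₁ (≤-<-trans (<corner⇒≤ i<x x-corner) cell)
latticePt⇒hEdge (a , b , cell , x-corner , inj₂ refl) i<x =
  inj₂ (b , refl , ≤-<-trans (<corner⇒≤ i<x x-corner) cell)

latticePt⇒vEdge : ∀ {F x y j} → Descending F → LatticePt F x y → j < y → VEdge F x j
latticePt⇒vEdge D (a , b , cell , inj₁ refl , y-corner) j<y =
  inj₁ (<-≤-trans cell (⟨⟩-descending D (<corner⇒≤ j<y y-corner)))
latticePt⇒vEdge D (a , b , cell , inj₂ refl , y-corner) j<y =
  inj₂ (a , refl , <-≤-trans cell (⟨⟩-descending D (<corner⇒≤ j<y y-corner)))

hEdge⇒InF : ∀ {F x y} → Descending F → HEdge F x y → ∀ {j} → j ≤ pred y → InF F x j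
hEdge⇒InF D (inj₁ cell)               j≤y-1 = <-≤-trans cell (⟨⟩-descending D (≤-trans j≤y-1 pred[n]≤n))
hEdge⇒InF D (inj₂ (b , refl , cell)) j≤b   = <-≤-trans cell (⟨⟩-descending D j≤b)

vEdge⇒InF : ∀ {F x y} → VEdge F x y → ∀ {i} → i ≤ pred x → InF F i y
vEdge⇒InF (inj₁ cell)               i≤x-1 = ≤-<-trans (≤-trans i≤x-1 pred[n]≤n) cell
vEdge⇒InF (inj₂ (a , refl , cell)) i≤a   = ≤-<-trans i≤a cell

#parts> : ℕ → List ℕ → ℕ
#parts> j F = length (filter (λ r → suc j ≤? r) F)

#parts>-antitone : ∀ j F → #parts> (suc j) F ≤ #parts> j F
#parts>-antitone j F =
  length-mono-≤ (filter⁺ (λ r → suc (suc j) ≤? r) (λ r → suc j ≤? r) (λ { refl j+1<r → <⇒≤ j+1<r }) (⊆-refl {x = F}))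

#parts>-positive : ∀ F {j} → j < F ⟨ 1 ⟩ → 1 ≤ #parts> j F
#parts>-positive (r ∷ F) {j} j<r rewrite filter-accept (λ r → suc j ≤? r) {xs = F} j<r = s≤s z≤n

descending⇒≤head : ∀ {r F} → Descending (r ∷ F) → All (_≤ r) (r ∷ F)
descending⇒≤head = Linked⇒All {R = λ a b → b ≤ a} (λ b≤a c≤b → ≤-trans c≤b b≤a) ≤-refl

#parts>-none : ∀ {r F y} → Descending (r ∷ F) → r ≤ y → #parts> y (r ∷ F) ≡ 0
#parts>-none {y = y} D r≤y = cong length (filter-none (λ r → suc y ≤? r)
  (All.map (λ b≤r y<b → <⇒≱ (<-≤-trans y<b b≤r) r≤y) (descending⇒≤head D)))

#parts>⇒⟨⟩ : ∀ {F} → Descending F → ∀ {x y} → x < #parts> y F → y < F ⟨ suc x ⟩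
#parts>⇒⟨⟩ {r ∷ F} D {x} {y} x<# with r ≤? y
... | yes r≤y with () ← subst (x <_) (#parts>-none D r≤y) x<#
#parts>⇒⟨⟩ {r ∷ F} D {zero}  {y} _   | no r≰y = ≰⇒> r≰y
#parts>⇒⟨⟩ {r ∷ F} D {suc x} {y} x<# | no r≰y =
  #parts>⇒⟨⟩ (Linked.tail D) (≤-pred (subst (suc x <_) accept x<#))
  where
  accept : #parts> y (r ∷ F) ≡ suc (#parts> y F)
  accept = cong length (filter-accept (λ r → suc y ≤? r) {xs = F} (≰⇒> r≰y))

applyUpTo-⟨⟩-≤ : ∀ h n y → applyUpTo h n ⟨ suc y ⟩ ≤ h y
applyUpTo-⟨⟩-≤ h zero    y       = z≤n
applyUpTo-⟨⟩-≤ h (suc n) zero    = ≤-refl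
applyUpTo-⟨⟩-≤ h (suc n) (suc y) = applyUpTo-⟨⟩-≤ (h ∘ suc) n y

conj-isPartition : ∀ F → IsPartition (conj F)
conj-isPartition F =
  applyUpTo⁺₂ (λ j → #parts> j F) (F ⟨ 1 ⟩) (λ j → #parts>-antitone j F) ,
  applyUpTo⁺₁ (λ j → #parts> j F) (F ⟨ 1 ⟩) (#parts>-positive F)

conj-InF : ∀ {F} → Descending F → ∀ {x y} → InF (conj F) x y → InF F y x
conj-InF {F} D {x} {y} cell =
  #parts>⇒⟨⟩ D (<-≤-trans cell (applyUpTo-⟨⟩-≤ (λ j → #parts> j F) (F ⟨ 1 ⟩) y))

conj-latticePt : ∀ {F} → Descending F → ∀ {x y} → LatticePt (conj F) x y → LatticePt F y x
conj-latticePt D (a , b , cell , x-corner , y-corner) = b , a , conj-InF D cell , y-corner , x-corner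

localRule-interlacing : ∀ k {m κ μ ν ρ} → LocalRule k m κ μ ν ρ → (κ ≺ μ) × (κ ≺ ν) × (μ ≺ ρ) × (ν ≺ ρ)
localRule-interlacing rsk      (κ≺μ , κ≺ν , μ≺ρ , ν≺ρ , _) = κ≺μ , κ≺ν , μ≺ρ , ν≺ρ
localRule-interlacing (drsk _) (_ , _ , _ , _ , κ≺μ , κ≺ν , μ≺ρ , ν≺ρ , _) = κ≺μ , κ≺ν , μ≺ρ , ν≺ρ

⊓+⊔-comm : ∀ a b c d → (a ⊓ b) + (c ⊔ d) ≡ (b ⊓ a) + (d ⊔ c)
⊓+⊔-comm a b c d = cong₂ _+_ (⊓-comm a b) (⊔-comm c d)

localRule-swap : ∀ k {m κ μ ν ρ} → LocalRule k m κ μ ν ρ → LocalRule k m κ ν μ ρ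
localRule-swap rsk {m} {κ} {μ} {ν} (κ≺μ , κ≺ν , μ≺ρ , ν≺ρ , first , rest) =
  κ≺ν , κ≺μ , ν≺ρ , μ≺ρ ,
  trans first (cong (m +_) (⊔-comm (μ ⟨ 1 ⟩) (ν ⟨ 1 ⟩))) ,
  λ i 2≤i → trans (rest i 2≤i) (⊓+⊔-comm (μ ⟨ i ∸ 1 ⟩) (ν ⟨ i ∸ 1 ⟩) (μ ⟨ i ⟩) (ν ⟨ i ⟩))
localRule-swap (drsk d) {m} {κ} {μ} {ν} (lκ , lμ , lν , lρ , κ≺μ , κ≺ν , μ≺ρ , ν≺ρ , m≡0⊎κd≡0 , first , rest) =
  lκ , lν , lμ , lρ , κ≺ν , κ≺μ , ν≺ρ , μ≺ρ , m≡0⊎κd≡0 ,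
  trans first (cong₂ _+_ (cong (m +_) (⊓-comm (μ ⟨ d ⟩) (ν ⟨ d ⟩))) (⊔-comm (μ ⟨ 1 ⟩) (ν ⟨ 1 ⟩))) ,
  λ i 2≤i i≤d → trans (rest i 2≤i i≤d) (⊓+⊔-comm (μ ⟨ i ∸ 1 ⟩) (ν ⟨ i ∸ 1 ⟩) (μ ⟨ i ⟩) (ν ⟨ i ⟩))

≺-entrywise : ∀ {α β} → α ≺ β → ∀ i → α ⟨ i ⟩ ≤ β ⟨ i ⟩
≺-entrywise α≺β zero    = z≤n
≺-entrywise α≺β (suc i) = proj₁ (α≺β i)

module _ {k F f P} (ok : KindOK k) (G : GrowthDiagram k F f P) where
  open GrowthDiagram G

  private
    D : Descending F
    D = proj₁ shape

  vEdge-≺ : ∀ {x y} → VEdge F x y → P x y ≺ P x (suc y)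
  vEdge-≺ (inj₁ cell) with localRule-interlacing k (local _ _ cell)
  ... | κ≺μ , _ = κ≺μ
  vEdge-≺ (inj₂ (a , refl , cell)) with localRule-interlacing k (local a _ cell)
  ... | _ , _ , _ , ν≺ρ = ν≺ρ

  hEdge-≺ : ∀ {x y} → HEdge F x y → P x y ≺ P (suc x) y
  hEdge-≺ (inj₁ cell) with localRule-interlacing k (local _ _ cell)
  ... | _ , κ≺ν , _ = κ≺ν
  hEdge-≺ (inj₂ (b , refl , cell)) with localRule-interlacing k (local _ b cell)
  ... | _ , _ , μ≺ρ , _ = μ≺ρ

  -- Walk up the column of x to height y′, then right along row y′.
  entrywise-monotone : ∀ {x y x′ y′} → LatticePt F x′ y′ → x ≤ x′ → y ≤ y′ →
    ∀ i → P x y ⟨ i ⟩ ≤ P x′ y′ ⟨ i ⟩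
  entrywise-monotone {x} {y} {x′} {y′} L′ x≤x′ y≤y′ i = ≤-trans
    (≤-chain (λ j → P x j ⟨ i ⟩)
      (λ j j<y′ → ≺-entrywise (vEdge-≺ (latticePt⇒vEdge D (latticePt-leftward {F} L′ x≤x′) j<y′)) i) y≤y′)
    (≤-chain (λ j → P j y′ ⟨ i ⟩)
      (λ j j<x′ → ≺-entrywise (hEdge-≺ (latticePt⇒hEdge {F} L′ j<x′)) i) x≤x′)

  column-size : ∀ x y → HEdge F x y → size (P x y) + colSum f x y ≡ size (P (suc x) y)
  column-size x y edge =
    ∑-along-strip (λ j → size (P x j)) (λ j → size (P (suc x) j)) (f x) y
      (cong size (trans (axisX x (x , 0 , bottom , inj₁ refl , inj₁ refl))
                        (sym (axisX (suc x) (x , 0 , bottom , inj₂ refl , inj₁ refl)))))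
      (λ j j<y → localRule⇒sizeLaw k ok (local x j (hEdge⇒InF D edge (<⇒≤pred j<y))))
    where
    bottom : InF F x 0
    bottom = hEdge⇒InF D edge z≤n

  row-size : ∀ x y → VEdge F x y → size (P x y) + rowSum f x y ≡ size (P x (suc y))
  row-size x y edge =
    ∑-along-strip (λ i → size (P i y)) (λ i → size (P i (suc y))) (λ i → f i y) x
      (cong size (trans (axisY y (0 , y , leftmost , inj₁ refl , inj₁ refl))
                        (sym (axisY (suc y) (0 , y , leftmost , inj₁ refl , inj₂ refl)))))
      (λ i i<x → localRule⇒sizeLaw k ok (localRule-swap k (local i y (vEdge⇒InF {F} edge (<⇒≤pred i<x)))))
    where
    leftmost : InF F 0 y
    leftmost = vEdge⇒InF {F} edge z≤n

  transpose : GrowthDiagram k (conj F) (λ x y → f y x) (λ x y → P y x)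
  transpose = record
    { shape = conj-isPartition F
    ; parts = λ x y L → parts y x (conj-latticePt D L)
    ; axisX = λ x L → axisY x (conj-latticePt D L)
    ; axisY = λ y L → axisX y (conj-latticePt D L)
    ; local = λ x y cell → localRule-swap k (local y x (conj-InF D cell))
    }

proposition3p1 : (k : Kind) → KindOK k →
    (F : List ℕ) (f : ℕ → ℕ → ℕ) (P : ℕ → ℕ → List ℕ) →
    GrowthDiagram k F f P →
    (∀ x y x′ y′ → LatticePt F x y → LatticePt F x′ y′ → x ≤ x′ → y ≤ y′ →
       ∀ i → P x y ⟨ i ⟩ ≤ P x′ y′ ⟨ i ⟩)
    × (∀ x y → HEdge F x y → size (P x y) + colSum f x y ≡ size (P (suc x) y))
    × (∀ x y → VEdge F x y → size (P x y) + rowSum f x y ≡ size (P x (suc y)))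
    × GrowthDiagram k (conj F) (λ x y → f y x) (λ x y → P y x)
proposition3p1 k ok F f P G =
  (λ _ _ _ _ _ L′ → entrywise-monotone ok G L′) ,
  column-size ok G , row-size ok G , transpose ok G
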